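{- Let $G$ be a graph of order $n$. Then $\gamma_{\{R2\}}(G)=4$ if and only if $\Delta(G)\leq n-3$, $\gamma_2(G)\geq 4$, and $G$ satisfies at least one of the following conditions: (i) $\gamma(G)=2$; (ii) $\gamma_2(G)=4$; (iii) there exists a vertex $v\in V(G)$ such that $\gamma_2(G[V(G)\setminus N[v]])=2$.
   Context: All graphs are finite and simple. A Roman $\{2\}$-dominating function on a graph $G=(V,E)$ is a function $f:V\to\{0,1,2\}$ such that for every vertex $v$ with $f(v)=0$, $\sum_{u\in N(v)}f(u)\geq 2$. Its weight is $\sum_{v\in V}f(v)$, and $\gamma_{\{R2\}}(G)$ is the minimum weight of such a function. $\Delta(G)$ is the maximum degree, $\gamma(G)$ the domination number, $N[v]=N(v)\cup\{v\}$ the closed neighborhood, and $G[S]$ the subgraph induced by $S$. A subset $S\subseteq V$ is a $2$-dominating set if every vertex of $V\setminus S$ has at least two neighbors in $S$; $\gamma_2(G)$ is the minimum cardinality of a $2$-dominating set. -}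

module Defs where

open import Data.Nat using (ℕ; zero; suc; _+_; _≤_; _⊔_)
open import Data.Bool using (Bool; true; false; T; not; _∧_; if_then_else_)
open import Data.Fin using (Fin; toℕ; _≟_)
open import Data.List using (List; map; allFin; foldr)
open import Data.Nat.ListAction using (sum)
open import Relation.Nullary using (yes; no)
open import Data.Product using (Σ; _×_; _,_; ∃)
open import Relation.Binary.PropositionalEquality using (_≡_)

record Graph (n : ℕ) : Set where
  field
    adj   : Fin n → Fin n → Bool
    sym   : ∀ u v → adj u v ≡ adj v u
    irrefl : ∀ v → adj v v ≡ false
open Graph public

Σᵥ : {n : ℕ} → (Fin n → ℕ) → ℕ
Σᵥ {n} f = sum (map f (allFin n))

b2n : Bool → ℕ
b2n true  = 1
b2n false = 0

VSet : ℕ → Set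
VSet n = Fin n → Bool

_⊆_ : {n : ℕ} → VSet n → VSet n → Set
_⊆_ {n} S W = ∀ v → T (S v) → T (W v)

card : {n : ℕ} → VSet n → ℕ
card S = Σᵥ (λ v → b2n (S v))

allV : {n : ℕ} → VSet n
allV _ = true

closedNbhd : {n : ℕ} → Graph n → Fin n → VSet n
closedNbhd {n} G v u with u ≟ v
... | yes _ = true
... | no _  = adj G v u

outsideClosedNbhd : {n : ℕ} → Graph n → Fin n → VSet n
outsideClosedNbhd G v u = not (closedNbhd G v u)

-- An induced subgraph G[W] is represented by the pair (G , W):
-- its vertices are those u with W u, and two such vertices are adjacent
-- in G[W] iff they are adjacent in G.  All notions below are relative to W;
-- taking W = allV gives the notion for G itself.

-- Number of neighbours of x lying in S (for S ⊆ W these are exactly the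
-- neighbours of x in S in the induced subgraph G[W]).
nbrsIn : {n : ℕ} → Graph n → VSet n → Fin n → ℕ
nbrsIn G S x = Σᵥ (λ u → b2n (adj G x u ∧ S u))

deg : {n : ℕ} → Graph n → Fin n → ℕ
deg G v = nbrsIn G allV v

-- Maximum degree Δ(G) (0 for the empty graph).
Δ : {n : ℕ} → Graph n → ℕ
Δ {n} G = foldr _⊔_ 0 (map (deg G) (allFin n))

IsMin : {A : Set} → (A → Set) → (A → ℕ) → ℕ → Set
IsMin {A} P w k = (Σ A (λ x → P x × w x ≡ k)) × (∀ x → P x → k ≤ w x)

IsDominating : {n : ℕ} → Graph n → VSet n → VSet n → Set
IsDominating G W S =
  S ⊆ W × (∀ x → T (W x) → T (not (S x)) → 1 ≤ nbrsIn G S x)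

Is2Dominating : {n : ℕ} → Graph n → VSet n → VSet n → Set
Is2Dominating G W S =
  S ⊆ W × (∀ x → T (W x) → T (not (S x)) → 2 ≤ nbrsIn G S x)

γ-is : {n : ℕ} → Graph n → ℕ → Set
γ-is G k = IsMin (IsDominating G allV) card k

γ₂-of-is : {n : ℕ} → Graph n → VSet n → ℕ → Set
γ₂-of-is G W k = IsMin (Is2Dominating G W) card k

γ₂-is : {n : ℕ} → Graph n → ℕ → Set
γ₂-is G k = γ₂-of-is G allV k

weightR : {n : ℕ} → (Fin n → Fin 3) → ℕ
weightR f = Σᵥ (λ v → toℕ (f v))

IsR2DF : {n : ℕ} → Graph n → (Fin n → Fin 3) → Set
IsR2DF G f = ∀ v → toℕ (f v) ≡ 0 →
  2 ≤ Σᵥ (λ u → if adj G v u then toℕ (f u) else 0)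

γR2-is : {n : ℕ} → Graph n → ℕ → Set
γR2-is G k = IsMin (IsR2DF G) weightR k

-- All Roman {2}-dominating functions needed label a set D with 2 and a set S with 1; such a
-- labelling has weight 2|D| + |S| and is a Roman {2}-dominating function as soon as each
-- vertex outside D ∪ S has a neighbour in D or two neighbours in S.  The conditions (i)–(iii) give such functions of
-- weight 4 with (D, S) = (γ-set, ∅), (∅, γ₂-set), ({v}, γ₂-set of G − N[v]), and a vertex u
-- of degree at least n − 2 gives one of weight at most 3 with (D, S) = ({u}, V − N[u]).
-- Conversely, a function of weight w ≤ 4 is analysed through its labels.  Without a label 2
-- its support is a 2-dominating set of size w.  With f(u) = 2 the remaining weight w − 2 is
-- spread over at most two vertices.  If it is at most 1, every vertex outside N[u] needs a
-- positive label of its own, so deg u ≥ n − 2.  If it is 2, it is either a second 2 at v,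
-- making {u, v} dominating, or two 1s at v and x: every vertex labelled 0 and not adjacent
-- to u is then adjacent to both, so {u, x} or {u, v} dominates when u is adjacent to v or x,
-- and otherwise {v, x} 2-dominates G − N[u].

module Submission where

open import Defs renaming (sym to adj-sym)
open import Algebra.Properties.CommutativeSemigroup using (interchange)
open import Data.Bool using (Bool; true; false; T; not; _∧_; _∨_; if_then_else_)
open import Data.Bool.Properties using (∧-identityʳ; ∨-zeroʳ; T-≡; T-not-≡)
open import Data.Empty using (⊥; ⊥-elim)
open import Data.Fin using (Fin; zero; suc; toℕ; _≟_)
open import Data.Fin.Patterns using (0F; 1F; 2F)
open import Data.Fin.Properties using (toℕ≤pred[n]; any?; all?)
open import Data.Fin.Subset using (Subset)
open import Data.Fin.Subset.Properties using (anySubset?)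
open import Data.List using (map; tabulate; allFin)
open import Data.List.Properties using (map-tabulate; map-cong; foldr-preservesᵒ)
open import Data.List.Membership.Propositional.Properties using (∈-map⁺; ∈-map⁻; ∈-allFin; foldr-selective)
import Data.List.Relation.Unary.Any as Any
open import Data.Nat using (ℕ; zero; suc; _+_; _*_; _≤_; _<_; _≤?_; _<?_; z≤n; s≤s; z<s)
open import Data.Nat.ListAction using (sum)
open import Data.Nat.Properties hiding (_≟_)
import Data.Nat.Properties as ℕₚ
open import Data.Product using (_×_; _,_; ∃; proj₁; proj₂)
open import Data.Sum using (_⊎_; inj₁; inj₂; [_,_])
open import Data.Unit using (tt)
open import Data.Vec using (lookup) renaming (tabulate to tabulateᵥ)
open import Data.Vec.Properties using (lookup∘tabulate)
open import Function using (_∘_; id)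
open import Function.Bundles using (_⇔_; mk⇔; Equivalence)
open import Relation.Binary.PropositionalEquality hiding ([_])
open import Relation.Nullary using (Dec; does; yes; no; ¬_; contradiction)
open import Relation.Nullary.Decidable using (T?; _×-dec_; _→-dec_)
open import Relation.Unary using (Decidable)

Σᵥ-suc : ∀ {n} (g : Fin (suc n) → ℕ) → Σᵥ g ≡ g zero + Σᵥ (g ∘ suc)
Σᵥ-suc {n} g = cong (g zero +_) (cong sum (begin
  map g (tabulate suc)      ≡⟨ map-tabulate suc g ⟩
  tabulate (g ∘ suc)        ≡⟨ map-tabulate id (g ∘ suc) ⟨
  map (g ∘ suc) (allFin n)  ∎))
  where open ≡-Reasoning

Σᵥ-cong : ∀ {n} {g h : Fin n → ℕ} → g ≗ h → Σᵥ g ≡ Σᵥ h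
Σᵥ-cong {n} g≗h = cong sum (map-cong g≗h (allFin n))

Σᵥ-mono-≤ : ∀ {n} {g h : Fin n → ℕ} → (∀ x → g x ≤ h x) → Σᵥ g ≤ Σᵥ h
Σᵥ-mono-≤ {zero}          _   = z≤n
Σᵥ-mono-≤ {suc n} {g} {h} g≤h rewrite Σᵥ-suc g | Σᵥ-suc h =
  +-mono-≤ (g≤h zero) (Σᵥ-mono-≤ (g≤h ∘ suc))

Σᵥ-const : ∀ {n} c → Σᵥ {n} (λ _ → c) ≡ n * c
Σᵥ-const {zero}  c = refl
Σᵥ-const {suc n} c = trans (Σᵥ-suc {n} (λ _ → c)) (cong (c +_) (Σᵥ-const {n} c))

Σᵥ-distrib-+ : ∀ {n} (g h : Fin n → ℕ) → Σᵥ (λ x → g x + h x) ≡ Σᵥ g + Σᵥ h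
Σᵥ-distrib-+ {zero}  g h = refl
Σᵥ-distrib-+ {suc n} g h = begin
  Σᵥ (λ x → g x + h x)                                  ≡⟨ Σᵥ-suc (λ x → g x + h x) ⟩
  (g zero + h zero) + Σᵥ (λ x → g (suc x) + h (suc x))  ≡⟨ cong (g zero + h zero +_) (Σᵥ-distrib-+ (g ∘ suc) (h ∘ suc)) ⟩
  (g zero + h zero) + (Σᵥ (g ∘ suc) + Σᵥ (h ∘ suc))     ≡⟨ interchange +-commutativeSemigroup (g zero) (h zero) _ _ ⟩
  (g zero + Σᵥ (g ∘ suc)) + (h zero + Σᵥ (h ∘ suc))     ≡⟨ cong₂ _+_ (Σᵥ-suc g) (Σᵥ-suc h) ⟨
  Σᵥ g + Σᵥ h                                           ∎
  where open ≡-Reasoning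

Σᵥ-*ˡ : ∀ {n} c (g : Fin n → ℕ) → Σᵥ (λ x → c * g x) ≡ c * Σᵥ g
Σᵥ-*ˡ {zero}  c g = sym (*-zeroʳ c)
Σᵥ-*ˡ {suc n} c g = begin
  Σᵥ (λ x → c * g x)                     ≡⟨ Σᵥ-suc (λ x → c * g x) ⟩
  c * g zero + Σᵥ (λ x → c * g (suc x))  ≡⟨ cong (c * g zero +_) (Σᵥ-*ˡ c (g ∘ suc)) ⟩
  c * g zero + c * Σᵥ (g ∘ suc)          ≡⟨ *-distribˡ-+ c _ _ ⟨
  c * (g zero + Σᵥ (g ∘ suc))            ≡⟨ cong (c *_) (Σᵥ-suc g) ⟨
  c * Σᵥ g                               ∎
  where open ≡-Reasoning

Σᵥ>0⇒∃>0 : ∀ {n} (g : Fin n → ℕ) → 0 < Σᵥ g → ∃ λ x → 0 < g x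
Σᵥ>0⇒∃>0 {suc n} g Σg>0 with 0 <? g zero
... | yes g₀>0 = zero , g₀>0
... | no  g₀≯0 = let x , gx>0 = Σᵥ>0⇒∃>0 (g ∘ suc) Σg∘suc>0 in suc x , gx>0
  where
  Σg∘suc>0 : 0 < Σᵥ (g ∘ suc)
  Σg∘suc>0 = subst (λ m → 0 < m + Σᵥ (g ∘ suc)) (n≤0⇒n≡0 (≮⇒≥ g₀≯0)) (subst (0 <_) (Σᵥ-suc g) Σg>0)

∅ : ∀ {n} → VSet n
∅ _ = false

⁅_⁆ : ∀ {n} → Fin n → VSet n
⁅ v ⁆ y = does (y ≟ v)

infixr 6 _∪_

_∪_ : ∀ {n} → VSet n → VSet n → VSet n
(S ∪ S′) y = S y ∨ S′ y

⁅⁆-self : ∀ {n} (v : Fin n) → ⁅ v ⁆ v ≡ true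
⁅⁆-self v with v ≟ v
... | yes _   = refl
... | no v≢v = contradiction refl v≢v

∉⁅⁆ : ∀ {n} {v y : Fin n} → T (not (⁅ v ⁆ y)) → y ≢ v
∉⁅⁆ {v = v} {y} y∉ with y ≟ v
... | no y≢v = y≢v

∈⁅⁆∪⁅⁆ˡ : ∀ {n} (u v : Fin n) → (⁅ u ⁆ ∪ ⁅ v ⁆) u ≡ true
∈⁅⁆∪⁅⁆ˡ u v = cong (_∨ ⁅ v ⁆ u) (⁅⁆-self u)

∈⁅⁆∪⁅⁆ʳ : ∀ {n} (u v : Fin n) → (⁅ u ⁆ ∪ ⁅ v ⁆) v ≡ true
∈⁅⁆∪⁅⁆ʳ u v = trans (cong (⁅ u ⁆ v ∨_) (⁅⁆-self v)) (∨-zeroʳ _)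

∉⁅⁆∪⁅⁆ : ∀ {n} {u v y : Fin n} → T (not ((⁅ u ⁆ ∪ ⁅ v ⁆) y)) → y ≢ u × y ≢ v
∉⁅⁆∪⁅⁆ {u = u} {v} {y} y∉ with y ≟ u | y ≟ v
... | no y≢u | no y≢v = y≢u , y≢v

⁅⁆-disjoint : ∀ {n} {u v : Fin n} → u ≢ v → ∀ y → ⁅ u ⁆ y ∧ ⁅ v ⁆ y ≡ false
⁅⁆-disjoint {u = u} {v} u≢v y with y ≟ u | y ≟ v
... | yes refl | yes refl = contradiction refl u≢v
... | yes _    | no _     = refl
... | no _     | _        = refl

Σᵥ-⁅⁆ : ∀ {n} (v : Fin n) (g : Fin n → ℕ) → Σᵥ (λ y → if ⁅ v ⁆ y then g y else 0) ≡ g v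
Σᵥ-⁅⁆ {suc n} zero    g = begin
  Σᵥ (λ y → if ⁅ zero ⁆ y then g y else 0)  ≡⟨ Σᵥ-suc (λ y → if ⁅ zero ⁆ y then g y else 0) ⟩
  g zero + Σᵥ {n} (λ _ → 0)                 ≡⟨ cong (g zero +_) (trans (Σᵥ-const {n} 0) (*-zeroʳ n)) ⟩
  g zero + 0                                ≡⟨ +-identityʳ _ ⟩
  g zero                                    ∎
  where open ≡-Reasoning
Σᵥ-⁅⁆ {suc n} (suc v) g = trans (Σᵥ-suc (λ y → if ⁅ suc v ⁆ y then g y else 0)) (Σᵥ-⁅⁆ v (g ∘ suc))

b2n-∧ : ∀ a b → b2n (a ∧ b) ≡ (if b then b2n a else 0)
b2n-∧ true  true  = refl
b2n-∧ true  false = refl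
b2n-∧ false true  = refl
b2n-∧ false false = refl

b2n-∧-∨ : ∀ p a b → a ∧ b ≡ false → b2n (p ∧ (a ∨ b)) ≡ b2n (p ∧ a) + b2n (p ∧ b)
b2n-∧-∨ false _     _     _  = refl
b2n-∧-∨ true  true  true  ()
b2n-∧-∨ true  true  false _  = refl
b2n-∧-∨ true  false _     _  = refl

2≤b2n+b2n⇒ : ∀ {a b} → 2 ≤ b2n a + b2n b → a ≡ true × b ≡ true
2≤b2n+b2n⇒ {true}  {true}  _         = refl , refl
2≤b2n+b2n⇒ {true}  {false} (s≤s ())
2≤b2n+b2n⇒ {false} {true}  (s≤s ())
2≤b2n+b2n⇒ {false} {false} ()

Σᵥ-∧-⁅⁆ : ∀ {n} (P : VSet n) v → Σᵥ (λ y → b2n (P y ∧ ⁅ v ⁆ y)) ≡ b2n (P v)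
Σᵥ-∧-⁅⁆ P v = trans (Σᵥ-cong (λ y → b2n-∧ (P y) (⁅ v ⁆ y))) (Σᵥ-⁅⁆ v (λ y → b2n (P y)))

Σᵥ-∧-⁅⁆∪⁅⁆ : ∀ {n} (P : VSet n) {u v} → u ≢ v →
             Σᵥ (λ y → b2n (P y ∧ (⁅ u ⁆ ∪ ⁅ v ⁆) y)) ≡ b2n (P u) + b2n (P v)
Σᵥ-∧-⁅⁆∪⁅⁆ P {u} {v} u≢v = begin
  Σᵥ (λ y → b2n (P y ∧ (⁅ u ⁆ ∪ ⁅ v ⁆) y))
    ≡⟨ Σᵥ-cong (λ y → b2n-∧-∨ (P y) _ _ (⁅⁆-disjoint u≢v y)) ⟩
  Σᵥ (λ y → b2n (P y ∧ ⁅ u ⁆ y) + b2n (P y ∧ ⁅ v ⁆ y))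
    ≡⟨ Σᵥ-distrib-+ (λ y → b2n (P y ∧ ⁅ u ⁆ y)) (λ y → b2n (P y ∧ ⁅ v ⁆ y)) ⟩
  Σᵥ (λ y → b2n (P y ∧ ⁅ u ⁆ y)) + Σᵥ (λ y → b2n (P y ∧ ⁅ v ⁆ y))
    ≡⟨ cong₂ _+_ (Σᵥ-∧-⁅⁆ P u) (Σᵥ-∧-⁅⁆ P v) ⟩
  b2n (P u) + b2n (P v)
    ∎
  where open ≡-Reasoning

card-∅ : ∀ {n} → card {n} ∅ ≡ 0
card-∅ {n} = trans (Σᵥ-const {n} 0) (*-zeroʳ n)

card-⁅⁆ : ∀ {n} (v : Fin n) → card ⁅ v ⁆ ≡ 1
card-⁅⁆ = Σᵥ-∧-⁅⁆ allV

card-⁅⁆∪⁅⁆ : ∀ {n} {u v : Fin n} → u ≢ v → card (⁅ u ⁆ ∪ ⁅ v ⁆) ≡ 2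
card-⁅⁆∪⁅⁆ = Σᵥ-∧-⁅⁆∪⁅⁆ allV

card-≗ : ∀ {n} {S S′ : VSet n} → S ≗ S′ → card S ≡ card S′
card-≗ S≗S′ = Σᵥ-cong (cong b2n ∘ S≗S′)

card-compl : ∀ {n} (S : VSet n) → card S + card (not ∘ S) ≡ n
card-compl {n} S = begin
  card S + card (not ∘ S)              ≡⟨ Σᵥ-distrib-+ (b2n ∘ S) (b2n ∘ not ∘ S) ⟨
  Σᵥ (λ y → b2n (S y) + b2n (not (S y))) ≡⟨ Σᵥ-cong (λ y → b2n+b2n∘not (S y)) ⟩
  Σᵥ {n} (λ _ → 1)                     ≡⟨ Σᵥ-const {n} 1 ⟩
  n * 1                                ≡⟨ *-identityʳ n ⟩
  n                                    ∎
  where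
  open ≡-Reasoning
  b2n+b2n∘not : ∀ b → b2n b + b2n (not b) ≡ 1
  b2n+b2n∘not true  = refl
  b2n+b2n∘not false = refl

erase : ∀ {n} → Fin n → (Fin n → ℕ) → Fin n → ℕ
erase u g y = if ⁅ u ⁆ y then 0 else g y

erase-self : ∀ {n} (u : Fin n) g → erase u g u ≡ 0
erase-self u g rewrite ⁅⁆-self u = refl

erase-other : ∀ {n} {u y : Fin n} g → y ≢ u → erase u g y ≡ g y
erase-other {u = u} {y} g y≢u with y ≟ u
... | yes y≡u = contradiction y≡u y≢u
... | no _    = refl

erase≡suc⁻ : ∀ {n} {u y : Fin n} {k} g → erase u g y ≡ suc k → y ≢ u × g y ≡ suc k
erase≡suc⁻ {u = u} g e = y≢u , trans (sym (erase-other g y≢u)) e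
  where
  y≢u : _ ≢ u
  y≢u refl = 0≢1+n (trans (sym (erase-self u g)) e)

Σᵥ-erase : ∀ {n} (u : Fin n) g → Σᵥ g ≡ g u + Σᵥ (erase u g)
Σᵥ-erase u g = begin
  Σᵥ g                                                  ≡⟨ Σᵥ-cong split ⟩
  Σᵥ (λ y → (if ⁅ u ⁆ y then g y else 0) + erase u g y) ≡⟨ Σᵥ-distrib-+ (λ y → if ⁅ u ⁆ y then g y else 0) (erase u g) ⟩
  Σᵥ (λ y → if ⁅ u ⁆ y then g y else 0) + Σᵥ (erase u g) ≡⟨ cong (_+ Σᵥ (erase u g)) (Σᵥ-⁅⁆ u g) ⟩
  g u + Σᵥ (erase u g)                                  ∎
  where
  open ≡-Reasoning
  split : ∀ y → g y ≡ (if ⁅ u ⁆ y then g y else 0) + erase u g y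
  split y with ⁅ u ⁆ y
  ... | true  = sym (+-identityʳ _)
  ... | false = refl

Σᵥ-erase≡ : ∀ {n} (u : Fin n) g {k m} → Σᵥ g ≡ k + m → g u ≡ k → Σᵥ (erase u g) ≡ m
Σᵥ-erase≡ u g {k} Σg≡ gu≡k =
  +-cancelˡ-≡ k _ _ (trans (cong (_+ _) (sym gu≡k)) (trans (sym (Σᵥ-erase u g)) Σg≡))

≤Σᵥ : ∀ {n} (g : Fin n → ℕ) x → g x ≤ Σᵥ g
≤Σᵥ g x = subst (g x ≤_) (sym (Σᵥ-erase x g)) (m≤m+n _ _)

Σᵥ≡0⇒ : ∀ {n} {g : Fin n → ℕ} → Σᵥ g ≡ 0 → ∀ x → g x ≡ 0
Σᵥ≡0⇒ {g = g} Σg≡0 x = m+n≡0⇒m≡0 _ (trans (sym (Σᵥ-erase x g)) Σg≡0)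

Σᵥ≡1⇒ : ∀ {n} {g : Fin n → ℕ} → Σᵥ g ≡ 1 → ∃ λ x → g x ≡ 1 × (∀ y → y ≢ x → g y ≡ 0)
Σᵥ≡1⇒ {g = g} Σg≡1 with Σᵥ>0⇒∃>0 g (subst (0 <_) (sym Σg≡1) z<s)
... | x , gx>0 = x , gx≡1 , λ y y≢x → trans (sym (erase-other g y≢x)) (Σᵥ≡0⇒ (Σᵥ-erase≡ x g Σg≡1 gx≡1) y)
  where
  gx≡1 : g x ≡ 1
  gx≡1 = ≤-antisym (subst (g x ≤_) Σg≡1 (≤Σᵥ g x)) gx>0

Σᵥ≡2⇒ : ∀ {n} {g : Fin n → ℕ} → Σᵥ g ≡ 2 →
        (∃ λ v → g v ≡ 2 × (∀ y → y ≢ v → g y ≡ 0))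
        ⊎ (∃ λ v → ∃ λ x → v ≢ x × g v ≡ 1 × g x ≡ 1 × (∀ y → y ≢ v → y ≢ x → g y ≡ 0))
Σᵥ≡2⇒ {g = g} Σg≡2 with Σᵥ>0⇒∃>0 g (subst (0 <_) (sym Σg≡2) z<s)
... | v , gv>0 with g v ℕₚ.≟ 2
...   | yes gv≡2 = inj₁ (v , gv≡2 , λ y y≢v → trans (sym (erase-other g y≢v)) (Σᵥ≡0⇒ (Σᵥ-erase≡ v g Σg≡2 gv≡2) y))
...   | no gv≢2 =
  let x , g′x≡1 , rest = Σᵥ≡1⇒ (Σᵥ-erase≡ v g Σg≡2 gv≡1)
      x≢v , gx≡1       = erase≡suc⁻ g g′x≡1
  in inj₂ (v , x , x≢v ∘ sym , gv≡1 , gx≡1 , λ y y≢v y≢x → trans (sym (erase-other g y≢v)) (rest y y≢x))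
  where
  gv≡1 : g v ≡ 1
  gv≡1 = ≤-antisym (≤-pred (≤∧≢⇒< (subst (g v ≤_) Σg≡2 (≤Σᵥ g v)) gv≢2)) gv>0

card-closedNbhd : ∀ {n} (G : Graph n) u → card (closedNbhd G u) ≡ suc (deg G u)
card-closedNbhd G u = begin
  card (closedNbhd G u)
    ≡⟨ Σᵥ-cong split ⟩
  Σᵥ (λ y → (if ⁅ u ⁆ y then 1 else 0) + b2n (adj G u y ∧ true))
    ≡⟨ Σᵥ-distrib-+ (λ y → if ⁅ u ⁆ y then 1 else 0) (λ y → b2n (adj G u y ∧ true)) ⟩
  Σᵥ (λ y → if ⁅ u ⁆ y then 1 else 0) + deg G u
    ≡⟨ cong (_+ deg G u) (Σᵥ-⁅⁆ u (λ _ → 1)) ⟩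
  suc (deg G u)
    ∎
  where
  open ≡-Reasoning
  split : ∀ y → b2n (closedNbhd G u y) ≡ (if ⁅ u ⁆ y then 1 else 0) + b2n (adj G u y ∧ true)
  split y with y ≟ u
  ... | yes refl rewrite irrefl G y = refl
  ... | no _     rewrite ∧-identityʳ (adj G u y) = refl

card-outsideClosedNbhd : ∀ {n} (G : Graph n) u → card (outsideClosedNbhd G u) + suc (deg G u) ≡ n
card-outsideClosedNbhd G u = begin
  card (outsideClosedNbhd G u) + suc (deg G u)          ≡⟨ cong (card (outsideClosedNbhd G u) +_) (card-closedNbhd G u) ⟨
  card (outsideClosedNbhd G u) + card (closedNbhd G u) ≡⟨ +-comm (card (outsideClosedNbhd G u)) _ ⟩
  card (closedNbhd G u) + card (outsideClosedNbhd G u) ≡⟨ card-compl (closedNbhd G u) ⟩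
  _                                                    ∎
  where open ≡-Reasoning

outside⁻ : ∀ {n} {G : Graph n} {v y} → T (outsideClosedNbhd G v y) → y ≢ v × adj G v y ≡ false
outside⁻ {G = G} {v} {y} y∉N[v] with y ≟ v
... | no y≢v = y≢v , Equivalence.to T-not-≡ y∉N[v]

outside⁺ : ∀ {n} {G : Graph n} {v y} → y ≢ v → adj G v y ≡ false → T (outsideClosedNbhd G v y)
outside⁺ {G = G} {v} {y} y≢v v≁y with y ≟ v
... | yes y≡v = contradiction y≡v y≢v
... | no _    = Equivalence.from T-not-≡ v≁y

deg≤Δ : ∀ {n} (G : Graph n) u → deg G u ≤ Δ G
deg≤Δ {n} G u = foldr-preservesᵒ
  (λ x y → [ m≤n⇒m≤n⊔o y , m≤n⇒m≤o⊔n x ])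
  0 (map (deg G) (allFin n)) (inj₂ (Any.map ≤-reflexive (∈-map⁺ (deg G) (∈-allFin u))))

Δ-attained : ∀ {n} (G : Graph n) → Fin n → ∃ λ u → Δ G ≤ deg G u
Δ-attained {n} G v with foldr-selective ⊔-sel 0 (map (deg G) (allFin n))
... | inj₁ Δ≡0 = v , subst (_≤ deg G v) (sym Δ≡0) z≤n
... | inj₂ Δ∈  = let u , _ , Δ≡deg = ∈-map⁻ (deg G) Δ∈ in u , ≤-reflexive Δ≡deg

2≤outside⇔deg+3≤n : ∀ {n} (G : Graph n) u → 2 ≤ card (outsideClosedNbhd G u) ⇔ deg G u + 3 ≤ n
2≤outside⇔deg+3≤n {n} G u = mk⇔
  (λ 2≤a → ≤-trans (≤-reflexive (+-comm d 3)) (subst (2 + suc d ≤_) a+d≡n (+-monoˡ-≤ (suc d) 2≤a)))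
  (λ d+3≤n → +-cancelʳ-≤ (suc d) 2 _ (subst (3 + d ≤_) (sym a+d≡n) (subst (_≤ n) (+-comm d 3) d+3≤n)))
  where
  d = deg G u
  a+d≡n = card-outsideClosedNbhd G u

Δ+3≤n⇔2≤outside : ∀ {n} (G : Graph n) → Fin n → Δ G + 3 ≤ n ⇔ (∀ u → 2 ≤ card (outsideClosedNbhd G u))
Δ+3≤n⇔2≤outside G v = mk⇔
  (λ Δ+3≤n u → Equivalence.from (2≤outside⇔deg+3≤n G u) (≤-trans (+-monoˡ-≤ 3 (deg≤Δ G u)) Δ+3≤n))
  (λ 2≤outside → let u , Δ≤deg = Δ-attained G v in
     ≤-trans (+-monoˡ-≤ 3 Δ≤deg) (Equivalence.to (2≤outside⇔deg+3≤n G u) (2≤outside u)))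

nbrSum : ∀ {n} → Graph n → (Fin n → ℕ) → Fin n → ℕ
nbrSum G w x = Σᵥ (λ z → if adj G x z then w z else 0)

nbrSum-mono : ∀ {n} (G : Graph n) {w w′ : Fin n → ℕ} x →
              (∀ z → adj G x z ≡ true → w z ≤ w′ z) → nbrSum G w x ≤ nbrSum G w′ x
nbrSum-mono G {w} {w′} x w≤w′ = Σᵥ-mono-≤ termwise
  where
  termwise : ∀ z → (if adj G x z then w z else 0) ≤ (if adj G x z then w′ z else 0)
  termwise z with adj G x z in x~z
  ... | true  = w≤w′ z x~z
  ... | false = z≤n

nbrSum-*ˡ : ∀ {n} (G : Graph n) c (w : Fin n → ℕ) x → nbrSum G (λ z → c * w z) x ≡ c * nbrSum G w x
nbrSum-*ˡ G c w x = trans (Σᵥ-cong termwise) (Σᵥ-*ˡ c (λ z → if adj G x z then w z else 0))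
  where
  termwise : ∀ z → (if adj G x z then c * w z else 0) ≡ c * (if adj G x z then w z else 0)
  termwise z with adj G x z
  ... | true  = refl
  ... | false = sym (*-zeroʳ c)

nbrSum-b2n : ∀ {n} (G : Graph n) (S : VSet n) x → nbrSum G (λ z → b2n (S z)) x ≡ nbrsIn G S x
nbrSum-b2n G S x = Σᵥ-cong termwise
  where
  termwise : ∀ z → (if adj G x z then b2n (S z) else 0) ≡ b2n (adj G x z ∧ S z)
  termwise z with adj G x z
  ... | true  = refl
  ... | false = refl

adjacent⇒1≤nbrsIn : ∀ {n} (G : Graph n) {S x z} → adj G x z ≡ true → S z ≡ true → 1 ≤ nbrsIn G S x
adjacent⇒1≤nbrsIn G {S} {x} {z} x~z z∈S =
  subst (_≤ nbrsIn G S x) (cong₂ (λ a b → b2n (a ∧ b)) x~z z∈S) (≤Σᵥ (λ z → b2n (adj G x z ∧ S z)) z)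

nbrsIn-⁅⁆∪⁅⁆ : ∀ {n} (G : Graph n) {u v} → u ≢ v → ∀ x → nbrsIn G (⁅ u ⁆ ∪ ⁅ v ⁆) x ≡ b2n (adj G x u) + b2n (adj G x v)
nbrsIn-⁅⁆∪⁅⁆ G u≢v x = Σᵥ-∧-⁅⁆∪⁅⁆ (adj G x) u≢v

least-below : ∀ {Q : ℕ → Set} → Decidable Q → ∀ b →
              (∃ λ k → Q k × (∀ j → Q j → k ≤ j)) ⊎ (∀ j → j < b → ¬ Q j)
least-below Q? zero = inj₂ (λ _ ())
least-below {Q} Q? (suc b) with least-below Q? b
... | inj₁ least = inj₁ least
... | inj₂ none with Q? b
...   | yes qb = inj₁ (b , qb , λ j qj → ≮⇒≥ (λ j<b → none j j<b qj))
...   | no ¬qb = inj₂ none′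
  where
  none′ : ∀ j → j < suc b → ¬ Q j
  none′ j j<1+b with m<1+n⇒m<n∨m≡n j<1+b
  ... | inj₁ j<b  = none j j<b
  ... | inj₂ refl = ¬qb

least-witness : ∀ {Q : ℕ → Set} → Decidable Q → ∀ {m} → Q m → ∃ λ k → Q k × (∀ j → Q j → k ≤ j)
least-witness Q? {m} qm with least-below Q? (suc m)
... | inj₁ least = least
... | inj₂ none  = contradiction qm (none m ≤-refl)

is2Dominating? : ∀ {n} (G : Graph n) W S → Dec (Is2Dominating G W S)
is2Dominating? G W S =
  all? (λ v → T? (S v) →-dec T? (W v)) ×-dec
  all? (λ x → T? (W x) →-dec T? (not (S x)) →-dec 2 ≤? nbrsIn G S x)

is2Dominating-≗ : ∀ {n} {G : Graph n} {W S S′} → S ≗ S′ → Is2Dominating G W S → Is2Dominating G W S′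
is2Dominating-≗ {G = G} S≗S′ (S⊆W , dominated) =
  (λ v v∈S′ → S⊆W v (subst T (sym (S≗S′ v)) v∈S′)) ,
  λ x x∈W x∉S′ → subst (2 ≤_) (Σᵥ-cong (λ z → cong (λ b → b2n (adj G x z ∧ b)) (S≗S′ z)))
                          (dominated x x∈W (subst (T ∘ not) (sym (S≗S′ x)) x∉S′))

-- γ₂ is the least m admitting a 2-dominating set of size m; each level is decided by
-- enumerating the subsets of V.
γ₂-exists : ∀ {n} (G : Graph n) W {S} → Is2Dominating G W S → ∃ λ k → γ₂-of-is G W k × k ≤ card S
γ₂-exists {n} G W dom =
  let k , (s , dom-s , card≡k) , least = least-witness Q? (encode dom)
  in k , ((lookup s , dom-s , card≡k) , λ S′ dom′ → least _ (encode dom′)) , least _ (encode dom)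
  where
  Q : ℕ → Set
  Q m = ∃ λ (s : Subset n) → Is2Dominating G W (lookup s) × card (lookup s) ≡ m
  Q? : Decidable Q
  Q? m = anySubset? (λ s → is2Dominating? G W (lookup s) ×-dec card (lookup s) ℕₚ.≟ m)
  encode : ∀ {S} → Is2Dominating G W S → Q (card S)
  encode {S} dom =
    tabulateᵥ S , is2Dominating-≗ {G = G} (λ x → sym (lookup∘tabulate S x)) dom , card-≗ (lookup∘tabulate S)

-- Labellings with 2 on D and 1 on S

labelling : ∀ {n} → VSet n → VSet n → Fin n → Fin 3
labelling D S y = if D y then 2F else if S y then 1F else 0F

labelling≡0⁻ : ∀ {n} (D S : VSet n) x → toℕ (labelling D S x) ≡ 0 → T (not (D x)) × T (not (S x))
labelling≡0⁻ D S x eq with D x | S x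
labelling≡0⁻ D S x () | true  | _
labelling≡0⁻ D S x () | false | true
labelling≡0⁻ D S x eq | false | false = tt , tt

2*b2n≤labelling : ∀ {n} (D S : VSet n) y → 2 * b2n (D y) ≤ toℕ (labelling D S y)
2*b2n≤labelling D S y with D y
... | true  = ≤-refl
... | false = z≤n

b2n≤labelling : ∀ {n} (D S : VSet n) y → b2n (S y) ≤ toℕ (labelling D S y)
b2n≤labelling D S y with D y | S y
... | true  | true  = s≤s z≤n
... | true  | false = z≤n
... | false | true  = ≤-refl
... | false | false = z≤n

labelling-isR2DF : ∀ {n} (G : Graph n) {D S} →
  (∀ x → T (not (D x)) → T (not (S x)) → 1 ≤ nbrsIn G D x ⊎ 2 ≤ nbrsIn G S x) →
  IsR2DF G (labelling D S)
labelling-isR2DF G {D} {S} covered x eq with labelling≡0⁻ D S x eq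
... | x∉D , x∉S with covered x x∉D x∉S
...   | inj₁ 1≤D = begin
  2                                          ≤⟨ *-monoʳ-≤ 2 1≤D ⟩
  2 * nbrsIn G D x                           ≡⟨ cong (2 *_) (nbrSum-b2n G D x) ⟨
  2 * nbrSum G (λ z → b2n (D z)) x           ≡⟨ nbrSum-*ˡ G 2 (λ z → b2n (D z)) x ⟨
  nbrSum G (λ z → 2 * b2n (D z)) x           ≤⟨ nbrSum-mono G x (λ z _ → 2*b2n≤labelling D S z) ⟩
  nbrSum G (λ z → toℕ (labelling D S z)) x   ∎
  where open ≤-Reasoning
...   | inj₂ 2≤S = begin
  2                                          ≤⟨ 2≤S ⟩
  nbrsIn G S x                               ≡⟨ nbrSum-b2n G S x ⟨
  nbrSum G (λ z → b2n (S z)) x               ≤⟨ nbrSum-mono G x (λ z _ → b2n≤labelling D S z) ⟩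
  nbrSum G (λ z → toℕ (labelling D S z)) x   ∎
  where open ≤-Reasoning

weight-labelling : ∀ {n} {D S : VSet n} → (∀ y → T (D y) → T (not (S y))) →
                   weightR (labelling D S) ≡ 2 * card D + card S
weight-labelling {D = D} {S} disjoint = begin
  weightR (labelling D S)                       ≡⟨ Σᵥ-cong termwise ⟩
  Σᵥ (λ y → 2 * b2n (D y) + b2n (S y))          ≡⟨ Σᵥ-distrib-+ (λ y → 2 * b2n (D y)) (λ y → b2n (S y)) ⟩
  Σᵥ (λ y → 2 * b2n (D y)) + card S             ≡⟨ cong (_+ card S) (Σᵥ-*ˡ 2 (λ y → b2n (D y))) ⟩
  2 * card D + card S                           ∎
  where
  open ≡-Reasoning
  termwise : ∀ y → toℕ (labelling D S y) ≡ 2 * b2n (D y) + b2n (S y)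
  termwise y with D y | S y | disjoint y
  ... | true  | true  | y∉S = ⊥-elim (y∉S tt)
  ... | true  | false | _   = refl
  ... | false | true  | _   = refl
  ... | false | false | _   = refl

dominating⇒isR2DF : ∀ {n} (G : Graph n) {D} → IsDominating G allV D → IsR2DF G (labelling D ∅)
dominating⇒isR2DF G {D} (_ , dominated) = labelling-isR2DF G {D} {∅} (λ x x∉D _ → inj₁ (dominated x tt x∉D))

weight-dominating : ∀ {n} (D : VSet n) → weightR (labelling D ∅) ≡ 2 * card D
weight-dominating {n} D =
  trans (weight-labelling {D = D} {∅} (λ _ _ → tt)) (trans (cong (2 * card D +_) (card-∅ {n})) (+-identityʳ _))

2dominating⇒isR2DF : ∀ {n} (G : Graph n) {S} → Is2Dominating G allV S → IsR2DF G (labelling ∅ S)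
2dominating⇒isR2DF G {S} (_ , dominated) = labelling-isR2DF G {∅} {S} (λ x _ x∉S → inj₂ (dominated x tt x∉S))

weight-2dominating : ∀ {n} (S : VSet n) → weightR (labelling ∅ S) ≡ card S
weight-2dominating {n} S = trans (weight-labelling {D = ∅} {S} (λ _ ())) (cong (λ c → 2 * c + card S) (card-∅ {n}))

outside-2dominating⇒isR2DF : ∀ {n} (G : Graph n) {v S} →
  Is2Dominating G (outsideClosedNbhd G v) S → IsR2DF G (labelling ⁅ v ⁆ S)
outside-2dominating⇒isR2DF G {v} {S} (_ , dominated) = labelling-isR2DF G covered
  where
  covered : ∀ x → T (not (⁅ v ⁆ x)) → T (not (S x)) → 1 ≤ nbrsIn G ⁅ v ⁆ x ⊎ 2 ≤ nbrsIn G S x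
  covered x x∉⁅v⁆ x∉S with adj G v x in v~x
  ... | true  = inj₁ (adjacent⇒1≤nbrsIn G (trans (adj-sym G x v) v~x) (⁅⁆-self v))
  ... | false = inj₂ (dominated x (outside⁺ {G = G} (∉⁅⁆ x∉⁅v⁆) v~x) x∉S)

weight-outside-2dominating : ∀ {n} (G : Graph n) {v S} → S ⊆ outsideClosedNbhd G v →
                             weightR (labelling ⁅ v ⁆ S) ≡ 2 + card S
weight-outside-2dominating G {v} {S} S⊆outside =
  trans (weight-labelling disjoint) (cong (λ c → 2 * c + card S) (card-⁅⁆ v))
  where
  disjoint : ∀ y → T (⁅ v ⁆ y) → T (not (S y))
  disjoint y y∈⁅v⁆ with S y in y∈S
  ... | false = tt
  ... | true  with y ≟ v
  ...   | no _     = ⊥-elim y∈⁅v⁆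
  ...   | yes refl = proj₁ (outside⁻ {G = G} {v} (S⊆outside y (Equivalence.from T-≡ y∈S))) refl

2dominating-self : ∀ {n} (G : Graph n) W → Is2Dominating G W W
2dominating-self G W = (λ _ y∈W → y∈W) , vacuous
  where
  vacuous : ∀ x → T (W x) → T (not (W x)) → 2 ≤ nbrsIn G W x
  vacuous x x∈W x∉W with W x
  ... | true  = ⊥-elim x∉W
  ... | false = ⊥-elim x∈W

-- Characterisation of γ_{R2}(G) ≥ 4

4≤γR2 : ∀ {n} → Graph n → Set
4≤γR2 G = ∀ f → IsR2DF G f → 4 ≤ weightR f

4≤γR2⇒2≤card-dominating : ∀ {n} (G : Graph n) {D} → 4≤γR2 G → IsDominating G allV D → 2 ≤ card D
4≤γR2⇒2≤card-dominating G {D} low dom =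
  *-cancelˡ-≤ 2 (subst (4 ≤_) (weight-dominating D) (low _ (dominating⇒isR2DF G dom)))

4≤γR2⇒4≤card-2dominating : ∀ {n} (G : Graph n) {S} → 4≤γR2 G → Is2Dominating G allV S → 4 ≤ card S
4≤γR2⇒4≤card-2dominating G {S} low dom =
  subst (4 ≤_) (weight-2dominating S) (low _ (2dominating⇒isR2DF G dom))

4≤γR2⇒2≤card-outside-2dominating : ∀ {n} (G : Graph n) {v S} → 4≤γR2 G →
  Is2Dominating G (outsideClosedNbhd G v) S → 2 ≤ card S
4≤γR2⇒2≤card-outside-2dominating G low dom =
  +-cancelˡ-≤ 2 2 _ (subst (4 ≤_) (weight-outside-2dominating G (proj₁ dom)) (low _ (outside-2dominating⇒isR2DF G dom)))

-- A vertex u with fewer than two non-neighbours would carry the function that is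
-- 2 on u and 1 on V ∖ N[u], of weight at most 3.
4≤γR2⇒Δ+3≤n : ∀ {n} (G : Graph n) → 4≤γR2 G → Δ G + 3 ≤ n
4≤γR2⇒Δ+3≤n {zero}  G low with low (λ ()) (λ ())
... | ()
4≤γR2⇒Δ+3≤n {suc n} G low = Equivalence.from (Δ+3≤n⇔2≤outside G zero)
  (λ u → 4≤γR2⇒2≤card-outside-2dominating G low (2dominating-self G (outsideClosedNbhd G u)))

nonzero : Fin 3 → Bool
nonzero 0F      = false
nonzero (suc _) = true

support : ∀ {n} → (Fin n → Fin 3) → VSet n
support f y = nonzero (f y)

toℕ≡b2n∘nonzero : (i : Fin 3) → toℕ i ≢ 2 → toℕ i ≡ b2n (nonzero i)
toℕ≡b2n∘nonzero 0F  _   = refl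
toℕ≡b2n∘nonzero 1F  _   = refl
toℕ≡b2n∘nonzero 2F i≢2 = contradiction refl i≢2

∉support⇒≡0 : (i : Fin 3) → T (not (nonzero i)) → toℕ i ≡ 0
∉support⇒≡0 0F _ = refl

support-2dominating : ∀ {n} (G : Graph n) {f} → IsR2DF G f → (∀ y → toℕ (f y) ≢ 2) →
                      Is2Dominating G allV (support f)
support-2dominating G {f} isR2 no2 = (λ _ _ → tt) , λ x _ x∉S → begin
  2                                      ≤⟨ isR2 x (∉support⇒≡0 (f x) x∉S) ⟩
  nbrSum G (λ z → toℕ (f z)) x           ≡⟨ Σᵥ-cong (λ z → cong (λ m → if adj G x z then m else 0)
                                                                (toℕ≡b2n∘nonzero (f z) (no2 z))) ⟩
  nbrSum G (λ z → b2n (support f z)) x   ≡⟨ nbrSum-b2n G (support f) x ⟩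
  nbrsIn G (support f) x                 ∎
  where open ≤-Reasoning

card-support : ∀ {n} (f : Fin n → Fin 3) → (∀ y → toℕ (f y) ≢ 2) → card (support f) ≡ weightR f
card-support f no2 = Σᵥ-cong (λ y → sym (toℕ≡b2n∘nonzero (f y) (no2 y)))

-- Besides the 2 at u at most one unit of weight is left, and a vertex outside N[u]
-- labelled 0 would need two units from its neighbours; so V ∖ N[u] carries positive labels.
weight≤3∧2⇒outside≤1 : ∀ {n} (G : Graph n) {f u} → IsR2DF G f → weightR f ≤ 3 → toℕ (f u) ≡ 2 →
                       card (outsideClosedNbhd G u) ≤ 1
weight≤3∧2⇒outside≤1 {n} G {f} {u} isR2 weight≤3 fu≡2 = ≤-trans (Σᵥ-mono-≤ outside≤rest) rest≤1
  where
  w : Fin n → ℕ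
  w y = toℕ (f y)
  rest≤1 : Σᵥ (erase u w) ≤ 1
  rest≤1 = +-cancelˡ-≤ 2 _ 1 (subst (_≤ 3) (trans (Σᵥ-erase u w) (cong (_+ Σᵥ (erase u w)) fu≡2)) weight≤3)
  nbrSum≤rest : ∀ y → adj G y u ≡ false → nbrSum G w y ≤ Σᵥ (erase u w)
  nbrSum≤rest y y≁u = Σᵥ-mono-≤ termwise
    where
    termwise : ∀ z → (if adj G y z then w z else 0) ≤ erase u w z
    termwise z with z ≟ u
    ... | yes refl rewrite y≁u = z≤n
    ... | no _ with adj G y z
    ...   | true  = ≤-refl
    ...   | false = z≤n
  outside≤rest : ∀ y → b2n (outsideClosedNbhd G u y) ≤ erase u w y
  outside≤rest y with outsideClosedNbhd G u y in y∉N[u]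
  ... | false = z≤n
  ... | true  =
    let y≢u , u≁y = outside⁻ {G = G} (Equivalence.from T-≡ y∉N[u])
    in subst (1 ≤_) (sym (erase-other w y≢u)) (n≢0⇒n>0 λ wy≡0 →
         1+n≰n (≤-trans (isR2 y wy≡0) (≤-trans (nbrSum≤rest y (trans (adj-sym G y u) u≁y)) rest≤1)))

weight≤3⇒ : ∀ {n} (G : Graph n) {f} → IsR2DF G f → weightR f ≤ 3 →
            (∃ λ u → card (outsideClosedNbhd G u) ≤ 1) ⊎ (∃ λ S → Is2Dominating G allV S × card S ≤ 3)
weight≤3⇒ G {f} isR2 weight≤3 with any? (λ u → toℕ (f u) ℕₚ.≟ 2)
... | yes (u , fu≡2) = inj₁ (u , weight≤3∧2⇒outside≤1 G isR2 weight≤3 fu≡2)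
... | no ∄2 = inj₂ (support f , support-2dominating G isR2 no2 , subst (_≤ 3) (sym (card-support f no2)) weight≤3)
  where
  no2 : ∀ y → toℕ (f y) ≢ 2
  no2 y fy≡2 = ∄2 (y , fy≡2)

Δ+3≤n∧4≤γ₂⇒4≤γR2 : ∀ {n} (G : Graph n) → Δ G + 3 ≤ n → (∀ k → γ₂-is G k → 4 ≤ k) → 4≤γR2 G
Δ+3≤n∧4≤γ₂⇒4≤γR2 G Δ+3≤n 4≤γ₂ f isR2 = ≮⇒≥ λ weight<4 → impossible (weight≤3⇒ G isR2 (≤-pred weight<4))
  where
  impossible : (∃ λ u → card (outsideClosedNbhd G u) ≤ 1) ⊎ (∃ λ S → Is2Dominating G allV S × card S ≤ 3) → ⊥
  impossible (inj₁ (u , outside≤1)) =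
    1+n≰n (≤-trans (Equivalence.to (Δ+3≤n⇔2≤outside G u) Δ+3≤n u) outside≤1)
  impossible (inj₂ (S , dom , card≤3)) =
    let k , γ₂≡k , k≤card = γ₂-exists G allV dom in 1+n≰n (≤-trans (4≤γ₂ k γ₂≡k) (≤-trans k≤card card≤3))

4≤γR2⇔ : ∀ {n} (G : Graph n) → 4≤γR2 G ⇔ (Δ G + 3 ≤ n × (∀ k → γ₂-is G k → 4 ≤ k))
4≤γR2⇔ G = mk⇔
  (λ low → 4≤γR2⇒Δ+3≤n G low , λ { k ((S , dom , card≡k) , _) → subst (4 ≤_) card≡k (4≤γR2⇒4≤card-2dominating G low dom) })
  (λ (Δ+3≤n , 4≤γ₂) → Δ+3≤n∧4≤γ₂⇒4≤γR2 G Δ+3≤n 4≤γ₂)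

-- Functions of weight four

Conditions : ∀ {n} → Graph n → Set
Conditions {n} G = γ-is G 2 ⊎ γ₂-is G 4 ⊎ ∃ (λ (v : Fin n) → γ₂-of-is G (outsideClosedNbhd G v) 2)

conditions⇒weight4 : ∀ {n} (G : Graph n) → Conditions G → ∃ λ f → IsR2DF G f × weightR f ≡ 4
conditions⇒weight4 G (inj₁ ((D , dom , card≡2) , _)) =
  labelling D ∅ , dominating⇒isR2DF G dom , trans (weight-dominating D) (cong (2 *_) card≡2)
conditions⇒weight4 G (inj₂ (inj₁ ((S , dom , card≡4) , _))) =
  labelling ∅ S , 2dominating⇒isR2DF G dom , trans (weight-2dominating S) card≡4
conditions⇒weight4 G (inj₂ (inj₂ (v , (S , dom , card≡2) , _))) =
  labelling ⁅ v ⁆ S , outside-2dominating⇒isR2DF G dom ,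
  trans (weight-outside-2dominating G (proj₁ dom)) (cong (2 +_) card≡2)

dominating-pair⇒γ≡2 : ∀ {n} (G : Graph n) {u v} → 4≤γR2 G → u ≢ v →
                      IsDominating G allV (⁅ u ⁆ ∪ ⁅ v ⁆) → γ-is G 2
dominating-pair⇒γ≡2 G low u≢v dom = (_ , dom , card-⁅⁆∪⁅⁆ u≢v) , λ _ → 4≤γR2⇒2≤card-dominating G low

2dominating-pair⇒γ₂-outside≡2 : ∀ {n} (G : Graph n) {u v x} → 4≤γR2 G → v ≢ x →
  Is2Dominating G (outsideClosedNbhd G u) (⁅ v ⁆ ∪ ⁅ x ⁆) → γ₂-of-is G (outsideClosedNbhd G u) 2
2dominating-pair⇒γ₂-outside≡2 G low v≢x dom =
  (_ , dom , card-⁅⁆∪⁅⁆ v≢x) , λ _ → 4≤γR2⇒2≤card-outside-2dominating G low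

zero-elsewhere⇒pair-dominating : ∀ {n} (G : Graph n) {f u v} → IsR2DF G f →
  (∀ y → y ≢ u → y ≢ v → toℕ (f y) ≡ 0) → IsDominating G allV (⁅ u ⁆ ∪ ⁅ v ⁆)
zero-elsewhere⇒pair-dominating G {f} {u} {v} isR2 zero-elsewhere = (λ _ _ → tt) , dominated
  where
  open ≤-Reasoning
  bounded : ∀ z → toℕ (f z) ≤ 2 * b2n ((⁅ u ⁆ ∪ ⁅ v ⁆) z)
  bounded z with z ≟ u | z ≟ v
  ... | yes _  | _      = toℕ≤pred[n] (f z)
  ... | no _   | yes _  = toℕ≤pred[n] (f z)
  ... | no z≢u | no z≢v = ≤-reflexive (zero-elsewhere z z≢u z≢v)
  dominated : ∀ x → T true → T (not ((⁅ u ⁆ ∪ ⁅ v ⁆) x)) → 1 ≤ nbrsIn G (⁅ u ⁆ ∪ ⁅ v ⁆) x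
  dominated x _ x∉ = let x≢u , x≢v = ∉⁅⁆∪⁅⁆ x∉ in *-cancelˡ-≤ 2 (begin
    2                                                ≤⟨ isR2 x (zero-elsewhere x x≢u x≢v) ⟩
    nbrSum G (λ z → toℕ (f z)) x                     ≤⟨ nbrSum-mono G x (λ z _ → bounded z) ⟩
    nbrSum G (λ z → 2 * b2n ((⁅ u ⁆ ∪ ⁅ v ⁆) z)) x   ≡⟨ nbrSum-*ˡ G 2 (λ z → b2n ((⁅ u ⁆ ∪ ⁅ v ⁆) z)) x ⟩
    2 * nbrSum G (λ z → b2n ((⁅ u ⁆ ∪ ⁅ v ⁆) z)) x   ≡⟨ cong (2 *_) (nbrSum-b2n G (⁅ u ⁆ ∪ ⁅ v ⁆) x) ⟩
    2 * nbrsIn G (⁅ u ⁆ ∪ ⁅ v ⁆) x                   ∎)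

module _ {n} (G : Graph n) {f : Fin n → Fin 3} (isR2 : IsR2DF G f) {u v x : Fin n}
         (v≢x : v ≢ x) (fv≡1 : toℕ (f v) ≡ 1) (fx≡1 : toℕ (f x) ≡ 1)
         (zero-elsewhere : ∀ y → y ≢ u → y ≢ v → y ≢ x → toℕ (f y) ≡ 0) where

  nonadjacent⇒adjacent-to-both : ∀ y → toℕ (f y) ≡ 0 → adj G y u ≡ false → adj G y v ≡ true × adj G y x ≡ true
  nonadjacent⇒adjacent-to-both y fy≡0 y≁u = 2≤b2n+b2n⇒ (begin
    2                                            ≤⟨ isR2 y fy≡0 ⟩
    nbrSum G (λ z → toℕ (f z)) y                 ≤⟨ nbrSum-mono G y bounded ⟩
    nbrSum G (λ z → b2n ((⁅ v ⁆ ∪ ⁅ x ⁆) z)) y   ≡⟨ nbrSum-b2n G (⁅ v ⁆ ∪ ⁅ x ⁆) y ⟩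
    nbrsIn G (⁅ v ⁆ ∪ ⁅ x ⁆) y                   ≡⟨ nbrsIn-⁅⁆∪⁅⁆ G v≢x y ⟩
    b2n (adj G y v) + b2n (adj G y x)            ∎)
    where
    open ≤-Reasoning
    bounded : ∀ z → adj G y z ≡ true → toℕ (f z) ≤ b2n ((⁅ v ⁆ ∪ ⁅ x ⁆) z)
    bounded z y~z with z ≟ u
    ... | yes refl = contradiction (trans (sym y~z) y≁u) λ ()
    ... | no z≢u with z ≟ v | z ≟ x
    ...   | yes refl | _        = ≤-reflexive fv≡1
    ...   | no _     | yes refl = ≤-reflexive fx≡1
    ...   | no z≢v   | no z≢x   = ≤-reflexive (zero-elsewhere z z≢u z≢v z≢x)

  neighbour⇒dominating : adj G u v ≡ true → IsDominating G allV (⁅ u ⁆ ∪ ⁅ x ⁆)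
  neighbour⇒dominating u~v = (λ _ _ → tt) , λ y _ y∉ → let y≢u , y≢x = ∉⁅⁆∪⁅⁆ y∉ in dominated y y≢u y≢x
    where
    dominated : ∀ y → y ≢ u → y ≢ x → 1 ≤ nbrsIn G (⁅ u ⁆ ∪ ⁅ x ⁆) y
    dominated y y≢u y≢x with y ≟ v
    ... | yes refl = adjacent⇒1≤nbrsIn G (trans (adj-sym G y u) u~v) (∈⁅⁆∪⁅⁆ˡ u x)
    ... | no y≢v with adj G y u in y~u
    ...   | true  = adjacent⇒1≤nbrsIn G y~u (∈⁅⁆∪⁅⁆ˡ u x)
    ...   | false = adjacent⇒1≤nbrsIn G
                      (proj₂ (nonadjacent⇒adjacent-to-both y (zero-elsewhere y y≢u y≢v y≢x) y~u)) (∈⁅⁆∪⁅⁆ʳ u x)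

  nonneighbours⇒2dominating-outside : v ≢ u → x ≢ u → adj G u v ≡ false → adj G u x ≡ false →
                                      Is2Dominating G (outsideClosedNbhd G u) (⁅ v ⁆ ∪ ⁅ x ⁆)
  nonneighbours⇒2dominating-outside v≢u x≢u u≁v u≁x = inside , dominated
    where
    inside : (⁅ v ⁆ ∪ ⁅ x ⁆) ⊆ outsideClosedNbhd G u
    inside y y∈ with y ≟ v | y ≟ x
    ... | yes refl | _        = outside⁺ {G = G} v≢u u≁v
    ... | no _     | yes refl = outside⁺ {G = G} x≢u u≁x
    dominated : ∀ y → T (outsideClosedNbhd G u y) → T (not ((⁅ v ⁆ ∪ ⁅ x ⁆) y)) → 2 ≤ nbrsIn G (⁅ v ⁆ ∪ ⁅ x ⁆) y
    dominated y y∉N[u] y∉ =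
      let y≢u , u≁y = outside⁻ {G = G} y∉N[u]
          y≢v , y≢x = ∉⁅⁆∪⁅⁆ y∉
          y~v , y~x = nonadjacent⇒adjacent-to-both y (zero-elsewhere y y≢u y≢v y≢x) (trans (adj-sym G y u) u≁y)
      in ≤-reflexive (sym (trans (nbrsIn-⁅⁆∪⁅⁆ G v≢x y) (cong₂ (λ a b → b2n a + b2n b) y~v y~x)))

two-ones⇒conditions : ∀ {n} (G : Graph n) {f u v x} → 4≤γR2 G → IsR2DF G f →
  u ≢ v → u ≢ x → v ≢ x → toℕ (f v) ≡ 1 → toℕ (f x) ≡ 1 →
  (∀ y → y ≢ u → y ≢ v → y ≢ x → toℕ (f y) ≡ 0) → Conditions G
two-ones⇒conditions G {u = u} {v} {x} low isR2 u≢v u≢x v≢x fv≡1 fx≡1 zero-elsewhere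
  with adj G u v in u~v | adj G u x in u~x
... | true  | _     = inj₁ (dominating-pair⇒γ≡2 G low u≢x (neighbour⇒dominating G isR2 v≢x fv≡1 fx≡1 zero-elsewhere u~v))
... | false | true  = inj₁ (dominating-pair⇒γ≡2 G low u≢v
                        (neighbour⇒dominating G isR2 (v≢x ∘ sym) fx≡1 fv≡1 (λ y a b c → zero-elsewhere y a c b) u~x))
... | false | false = inj₂ (inj₂ (u , 2dominating-pair⇒γ₂-outside≡2 G low v≢x
                        (nonneighbours⇒2dominating-outside G isR2 v≢x fv≡1 fx≡1 zero-elsewhere (u≢v ∘ sym) (u≢x ∘ sym) u~v u~x)))

no2⇒γ₂≡4 : ∀ {n} (G : Graph n) {f} → 4≤γR2 G → IsR2DF G f → weightR f ≡ 4 →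
           (∀ y → toℕ (f y) ≢ 2) → γ₂-is G 4
no2⇒γ₂≡4 G {f} low isR2 weight≡4 no2 =
  (support f , support-2dominating G isR2 no2 , trans (card-support f no2) weight≡4) ,
  λ _ → 4≤γR2⇒4≤card-2dominating G low

Σᵥ-erase≡2⇒conditions : ∀ {n} (G : Graph n) {f u} → 4≤γR2 G → IsR2DF G f →
                    Σᵥ (erase u (λ y → toℕ (f y))) ≡ 2 → Conditions G
Σᵥ-erase≡2⇒conditions G {f} {u} low isR2 Σf′≡2 with Σᵥ≡2⇒ Σf′≡2
... | inj₁ (v , f′v≡2 , zero-elsewhere) =
  let v≢u , _ = erase≡suc⁻ (λ y → toℕ (f y)) f′v≡2 in
  inj₁ (dominating-pair⇒γ≡2 G low (v≢u ∘ sym) (zero-elsewhere⇒pair-dominating G isR2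
    (λ y y≢u y≢v → trans (sym (erase-other (λ y → toℕ (f y)) y≢u)) (zero-elsewhere y y≢v))))
... | inj₂ (v , x , v≢x , f′v≡1 , f′x≡1 , zero-elsewhere) =
  let v≢u , fv≡1 = erase≡suc⁻ (λ y → toℕ (f y)) f′v≡1
      x≢u , fx≡1 = erase≡suc⁻ (λ y → toℕ (f y)) f′x≡1
  in two-ones⇒conditions G low isR2 (v≢u ∘ sym) (x≢u ∘ sym) v≢x fv≡1 fx≡1
       (λ y y≢u y≢v y≢x → trans (sym (erase-other (λ y → toℕ (f y)) y≢u)) (zero-elsewhere y y≢v y≢x))

weight4⇒conditions : ∀ {n} (G : Graph n) {f} → 4≤γR2 G → IsR2DF G f → weightR f ≡ 4 → Conditions G
weight4⇒conditions G {f} low isR2 weight≡4 with any? (λ u → toℕ (f u) ℕₚ.≟ 2)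
... | yes (u , fu≡2) = Σᵥ-erase≡2⇒conditions G low isR2 (Σᵥ-erase≡ u (λ y → toℕ (f y)) weight≡4 fu≡2)
... | no ∄2          = inj₂ (inj₁ (no2⇒γ₂≡4 G low isR2 weight≡4 λ y fy≡2 → ∄2 (y , fy≡2)))

proposition2p3 : (n : ℕ) (G : Graph n) →
    γR2-is G 4 ⇔
      ((Δ G + 3 ≤ n)
       × (∀ k → γ₂-is G k → 4 ≤ k)
       × (γ-is G 2
          ⊎ γ₂-is G 4
          ⊎ ∃ (λ (v : Fin n) → γ₂-of-is G (outsideClosedNbhd G v) 2)))
proposition2p3 n G = mk⇔
  (λ ((f , isR2 , weight≡4) , low) →
     let Δ+3≤n , 4≤γ₂ = Equivalence.to (4≤γR2⇔ G) low
     in Δ+3≤n , 4≤γ₂ , weight4⇒conditions G low isR2 weight≡4)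
  (λ (Δ+3≤n , 4≤γ₂ , conditions) →
     conditions⇒weight4 G conditions , Equivalence.from (4≤γR2⇔ G) (Δ+3≤n , 4≤γ₂))
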